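{- Let $\Pi$ be a dynamic $\mathrm{UDyn}\Sigma_1^+$-program, let $w\in\Sigma^n$ and $w'\in\Sigma^m$, and let $\mathcal A,\mathcal A'$ be sets of auxiliary relations of arity at most $1$ over the schema of $\Pi$ on the domains of $w$ and $w'$ respectively. Suppose there is $I\subseteq[m]$ and an order-preserving mapping $\pi:[n]\to I$ such that $(w,\mathcal A)$ and $(w',\mathcal A')_{|I}$ are type-monotonic via $\pi$. Then for any $\pi$-respecting sequences of changes $\alpha,\alpha'$, the structures $\Pi_\alpha(w,\mathcal A)$ and $\Pi_{\alpha'}(w',\mathcal A')_{|I}$ are type-monotonic via $\pi$.
   Context: Dynamic descriptive complexity: words over $\Sigma\cup\{\epsilon\}$ encoded on domain $[n]=\{1,\dots,n\}$ with unary relations $W_\sigma$ and order $\le$; changes $\mathrm{set}_\sigma(i)$ set position $i$ to $\sigma$. A dynamic program has update formulas $\varphi^R_\sigma(\bar x;y)$; after $\mathrm{set}_\sigma(i)$ the new $R$ consists of the tuples $\bar a$ with $\varphi^R_\sigma(\bar a;i)$ true in (changed word, old auxiliary relations). A $\mathrm{UDyn}\Sigma_1^+$-program uses auxiliary relations of arity $\le 1$ (including $0$-ary bits) and update formulas in prenex $\exists^*$ form whose quantifier-free part has negations only directly in front of atoms $x\le y$. $\Pi_\alpha(w,\mathcal A)$ is the word with auxiliary relations obtained by applying the change sequence $\alpha$ and the corresponding updates of $\Pi$ to $(w,\mathcal A)$. $(w,\mathcal A)_{|I}$ is the restriction to positions in $I$. $\pi$ is order-preserving if $i<i'$ implies $\pi(i)<\pi(i')$.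 The type of position $i$ in $(w,\mathcal A)$ consists of $w_i$ and the set of relations of $\mathcal A$ containing $i$; $(w,\mathcal A)$ and $(w',\mathcal A')_{|I}$ are type-monotonic via $\pi$ if for every $i\in[n]$ the type of $i$ is a subset of the type of $\pi(i)$ (in particular $w_i=w'_{\pi(i)}$, and $R^{\mathcal A}(i)$ implies $R^{\mathcal A'}(\pi(i))$). Sequences $\alpha=\delta_1\cdots\delta_\ell$, $\alpha'=\delta'_1\cdots\delta'_\ell$ are $\pi$-respecting if whenever $\delta_t=\mathrm{set}_\sigma(j)$ then $\delta'_t=\mathrm{set}_\sigma(\pi(j))$.
   Formalization: The type of a position also contains the 0-ary auxiliary relations that hold, so type-monotonicity via π also requires every bit true in 𝒜 to be true in 𝒜′, in hypothesis and conclusion alike. The paper assumes this as well. -}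

module Defs where

open import Data.Nat using (ℕ; suc; _+_)
open import Data.Fin using (Fin; _≟_) renaming (_≤_ to _≤ᶠ_; _<_ to _<ᶠ_)
open import Data.Vec using (Vec; []; _∷_; _++_; lookup)
open import Data.List using (List)
open import Data.List.Relation.Binary.Pointwise using (Pointwise)
open import Data.Maybe using (Maybe; just)
open import Data.Product using (Σ; ∃; _×_)
open import Data.Sum using (_⊎_)
open import Data.Unit using (⊤)
open import Data.Empty using (⊥)
open import Relation.Nullary using (¬_; yes; no)
open import Relation.Binary.PropositionalEquality using (_≡_)

-- Alphabet `Alph` (= Σ); letters at positions range over Σ ∪ {ε}, modelled as
-- `Maybe Alph` (nothing = ε).
-- A schema of a UDyn-program: k unary auxiliary relations (Fin k) and
-- b nullary auxiliary relations / bits (Fin b).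

module _ (Alph : Set) (k b : ℕ) where

  -- Quantifier-free formulas over v variables, with negation only directly
  -- in front of order atoms x ≤ y.
  data QF (v : ℕ) : Set where
    tt ff   : QF v
    letter  : Alph → Fin v → QF v
    rel     : Fin k → Fin v → QF v
    bit     : Fin b → QF v
    eq      : Fin v → Fin v → QF v
    leq     : Fin v → Fin v → QF v
    nleq    : Fin v → Fin v → QF v
    and or  : QF v → QF v → QF v

  -- Update formula φ(x̄ ; y) with |x̄| = a in prenex ∃* form:
  -- ∃ z₁ … z_e . body(x̄, y, z̄); the body's variables are x̄ ++ y ∷ z̄.
  record UpdFormula (a : ℕ) : Set where
    field
      nex  : ℕ
      body : QF (a + suc nex)

  record Program : Set where
    field
      urelUpd : Maybe Alph → Fin k → UpdFormula 1
      bitUpd  : Maybe Alph → Fin b → UpdFormula 0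

  record Struct (n : ℕ) : Set₁ where
    field
      word : Fin n → Maybe Alph
      urel : Fin k → Fin n → Set
      bits : Fin b → Set

  open Struct

  ⟦_⟧ : ∀ {v n} → QF v → Struct n → (Fin v → Fin n) → Set
  ⟦ tt ⟧ S ρ = ⊤
  ⟦ ff ⟧ S ρ = ⊥
  ⟦ letter σ x ⟧ S ρ = word S (ρ x) ≡ just σ
  ⟦ rel R x ⟧ S ρ = urel S R (ρ x)
  ⟦ bit B ⟧ S ρ = bits S B
  ⟦ eq x y ⟧ S ρ = ρ x ≡ ρ y
  ⟦ leq x y ⟧ S ρ = ρ x ≤ᶠ ρ y
  ⟦ nleq x y ⟧ S ρ = ¬ (ρ x ≤ᶠ ρ y)
  ⟦ and φ ψ ⟧ S ρ = ⟦ φ ⟧ S ρ × ⟦ ψ ⟧ S ρ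
  ⟦ or φ ψ ⟧ S ρ = ⟦ φ ⟧ S ρ ⊎ ⟦ ψ ⟧ S ρ

  holdsUpd : ∀ {a n} → UpdFormula a → Struct n → Vec (Fin n) a → Fin n → Set
  holdsUpd {n = n} φ S xs y =
    ∃ λ (zs : Vec (Fin n) (UpdFormula.nex φ)) → ⟦ UpdFormula.body φ ⟧ S (lookup (xs ++ (y ∷ zs)))

  data Change (n : ℕ) : Set where
    set : Maybe Alph → Fin n → Change n

  updWord : ∀ {n} → (Fin n → Maybe Alph) → Fin n → Maybe Alph → Fin n → Maybe Alph
  updWord w i σ j with j ≟ i
  ... | yes _ = σ
  ... | no  _ = w j

  -- One update step: new auxiliary relations are evaluated on
  -- (changed word, old auxiliary relations).
  step : ∀ {n} → Program → Change n → Struct n → Struct n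
  step Π (set σ i) S = record
    { word = updWord (word S) i σ
    ; urel = λ R x → holdsUpd (Program.urelUpd Π σ R) S′ (x ∷ []) i
    ; bits = λ B → holdsUpd (Program.bitUpd Π σ B) S′ [] i
    }
    where
      S′ : Struct _
      S′ = record { word = updWord (word S) i σ ; urel = urel S ; bits = bits S }

  run : ∀ {n} → Program → List (Change n) → Struct n → Struct n
  run Π Data.List.[] S = S
  run Π (δ Data.List.∷ α) S = run Π α (step Π δ S)

  -- type of i (letter, unary relations containing i, true bits) is contained
  -- in the type of π(i)
  TypeMono : ∀ {n m} → (Fin n → Fin m) → Struct n → Struct m → Set
  TypeMono π S S′ =
    (∀ i → word S i ≡ word S′ (π i)) ×
    (∀ R i → urel S R i → urel S′ R (π i)) ×
    (∀ B → bits S B → bits S′ B)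

  RespectsChange : ∀ {n m} → (Fin n → Fin m) → Change n → Change m → Set
  RespectsChange π (set σ j) δ′ = δ′ ≡ set σ (π j)

  Respecting : ∀ {n m} → (Fin n → Fin m) → List (Change n) → List (Change m) → Set
  Respecting π = Pointwise (RespectsChange π)

OrderPreserving : ∀ {n m} → (Fin n → Fin m) → Set
OrderPreserving π = ∀ i i′ → i <ᶠ i′ → π i <ᶠ π i′

module Submission where

open import Defs
open import Data.Nat using (ℕ)
open import Data.Fin using (Fin; _≟_) renaming (_≤_ to _≤ᶠ_)
open import Data.Fin.Properties using (<-cmp; <⇒≢; ≤∧≢⇒<; ≤-refl)
open import Data.Nat.Properties using (<⇒≤; ≰⇒>; <⇒≱)
open import Data.Fin.Subset using (Subset; _∈_)
open import Data.List using (List; []; _∷_)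
open import Data.List.Relation.Binary.Pointwise using ([]; _∷_)
open import Data.Vec using ([]; _∷_; _++_; lookup; map)
open import Data.Vec.Properties using (lookup-map; map-++)
open import Data.Product using (_,_)
open import Data.Sum using (inj₁; inj₂)
open import Data.Maybe using (Maybe)
open import Data.Empty using (⊥-elim)
open import Function using (_∘_)
open import Function.Definitions using (Injective)
open import Relation.Binary using (tri<; tri≈; tri>)
open import Relation.Binary.PropositionalEquality using (_≡_; _≗_; refl; sym; trans; cong)
open import Relation.Nullary using (¬_; yes; no)

-- Update formulas are existential and positive up to order literals, so
-- their truth is preserved along any type-monotonic map that preserves ≤ and
-- ≰, existential witnesses being pushed forward.  A strictly monotone π does
-- both, and being injective it also moves the changed position i exactly to
-- π i.  So one update step keeps (S, S′) type-monotonic via π, and induction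
-- on the change sequences finishes the argument.

module _ {n m : ℕ} {π : Fin n → Fin m} (π-mono : OrderPreserving π) where

  OrderPreserving⇒injective : Injective _≡_ _≡_ π
  OrderPreserving⇒injective {i} {j} πi≡πj with <-cmp i j
  ... | tri< i<j _ _ = ⊥-elim (<⇒≢ (π-mono i j i<j) πi≡πj)
  ... | tri≈ _ i≡j _ = i≡j
  ... | tri> _ _ j<i = ⊥-elim (<⇒≢ (π-mono j i j<i) (sym πi≡πj))

  OrderPreserving⇒mono-≤ : ∀ {i j} → i ≤ᶠ j → π i ≤ᶠ π j
  OrderPreserving⇒mono-≤ {i} {j} i≤j with i ≟ j
  ... | yes refl = ≤-refl
  ... | no i≢j  = <⇒≤ (π-mono i j (≤∧≢⇒< i≤j i≢j))

  OrderPreserving⇒mono-≰ : ∀ {i j} → ¬ i ≤ᶠ j → ¬ π i ≤ᶠ π j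
  OrderPreserving⇒mono-≰ {i} {j} i≰j = <⇒≱ (π-mono j i (≰⇒> i≰j))

module _ {Alph : Set} {k b : ℕ} {n m : ℕ} {π : Fin n → Fin m}
         (π-mono : OrderPreserving π) where

  updWord-commute : ∀ {w : Fin n → Maybe Alph} {w′ : Fin m → Maybe Alph} →
    (∀ j → w j ≡ w′ (π j)) → ∀ i σ j →
    updWord Alph k b w i σ j ≡ updWord Alph k b w′ (π i) σ (π j)
  updWord-commute w≗w′∘π i σ j with j ≟ i | π j ≟ π i
  ... | yes _   | yes _    = refl
  ... | yes j≡i | no πj≢πi = ⊥-elim (πj≢πi (cong π j≡i))
  ... | no j≢i  | yes πj≡πi = ⊥-elim (j≢i (OrderPreserving⇒injective π-mono πj≡πi))
  ... | no _    | no _     = w≗w′∘π j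

  ⟦⟧-transfer : ∀ {v} (φ : QF Alph k b v) {S S′} → TypeMono Alph k b π S S′ →
    ∀ {ρ ρ′} → ρ′ ≗ π ∘ ρ → ⟦_⟧ Alph k b φ S ρ → ⟦_⟧ Alph k b φ S′ ρ′
  ⟦⟧-transfer tt _ _ _ = _
  ⟦⟧-transfer ff _ _ ()
  ⟦⟧-transfer (letter σ x) (word≡ , _) {ρ} ρ′≗π∘ρ h
    rewrite ρ′≗π∘ρ x = trans (sym (word≡ (ρ x))) h
  ⟦⟧-transfer (rel R x) (_ , urel⊆ , _) {ρ} ρ′≗π∘ρ h
    rewrite ρ′≗π∘ρ x = urel⊆ R (ρ x) h
  ⟦⟧-transfer (bit B) (_ , _ , bits⊆) _ h = bits⊆ B h
  ⟦⟧-transfer (eq x y) _ ρ′≗π∘ρ h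
    rewrite ρ′≗π∘ρ x | ρ′≗π∘ρ y = cong π h
  ⟦⟧-transfer (leq x y) _ ρ′≗π∘ρ h
    rewrite ρ′≗π∘ρ x | ρ′≗π∘ρ y = OrderPreserving⇒mono-≤ π-mono h
  ⟦⟧-transfer (nleq x y) _ ρ′≗π∘ρ h
    rewrite ρ′≗π∘ρ x | ρ′≗π∘ρ y = OrderPreserving⇒mono-≰ π-mono h
  ⟦⟧-transfer (and φ ψ) mono ρ′≗π∘ρ (hφ , hψ) =
    ⟦⟧-transfer φ mono ρ′≗π∘ρ hφ , ⟦⟧-transfer ψ mono ρ′≗π∘ρ hψ
  ⟦⟧-transfer (or φ ψ) mono ρ′≗π∘ρ (inj₁ hφ) = inj₁ (⟦⟧-transfer φ mono ρ′≗π∘ρ hφ)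
  ⟦⟧-transfer (or φ ψ) mono ρ′≗π∘ρ (inj₂ hψ) = inj₂ (⟦⟧-transfer ψ mono ρ′≗π∘ρ hψ)

  holdsUpd-transfer : ∀ {a} (φ : UpdFormula Alph k b a) {S S′} → TypeMono Alph k b π S S′ →
    ∀ xs y → holdsUpd Alph k b φ S xs y → holdsUpd Alph k b φ S′ (map π xs) (π y)
  holdsUpd-transfer φ mono xs y (zs , h) =
    map π zs , ⟦⟧-transfer (UpdFormula.body φ) mono lookup-map-++ h
    where
    lookup-map-++ : lookup (map π xs ++ (π y ∷ map π zs)) ≗ π ∘ lookup (xs ++ (y ∷ zs))
    lookup-map-++ x = trans (cong (λ v → lookup v x) (sym (map-++ π xs (y ∷ zs))))
                            (lookup-map x π (xs ++ (y ∷ zs)))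

  step-transfer : ∀ (Π : Program Alph k b) {δ δ′} → RespectsChange Alph k b π δ δ′ →
    ∀ {S S′} → TypeMono Alph k b π S S′ →
    TypeMono Alph k b π (step Alph k b Π δ S) (step Alph k b Π δ′ S′)
  step-transfer Π {set σ i} refl {S} {S′} (word≡ , rest) =
      word≡′
    , (λ R x → holdsUpd-transfer (Program.urelUpd Π σ R) changed (x ∷ []) i)
    , (λ B → holdsUpd-transfer (Program.bitUpd Π σ B) changed [] i)
    where
    word≡′ : ∀ j → updWord Alph k b (Struct.word S) i σ j
                 ≡ updWord Alph k b (Struct.word S′) (π i) σ (π j)
    word≡′ = updWord-commute word≡ i σ
    changed : TypeMono Alph k b π
      (record S { word = updWord Alph k b (Struct.word S) i σ })
      (record S′ { word = updWord Alph k b (Struct.word S′) (π i) σ })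
    changed = word≡′ , rest

  run-transfer : ∀ (Π : Program Alph k b) {α α′} → Respecting Alph k b π α α′ →
    ∀ {S S′} → TypeMono Alph k b π S S′ →
    TypeMono Alph k b π (run Alph k b Π α S) (run Alph k b Π α′ S′)
  run-transfer Π [] mono = mono
  run-transfer Π (δ∼δ′ ∷ α∼α′) mono = run-transfer Π α∼α′ (step-transfer Π δ∼δ′ mono)

-- The subset I never enters: type-monotonicity only inspects positions in the
-- image of π, which lies in I by assumption.
mainTheorem13 : {Alph : Set} {k b : ℕ} (Π : Program Alph k b) {n m : ℕ}
    (S : Struct Alph k b n) (S′ : Struct Alph k b m)
    (I : Subset m) (π : Fin n → Fin m) →
    (∀ i → π i ∈ I) → OrderPreserving π →
    TypeMono Alph k b π S S′ →
    (α : List (Change Alph k b n)) (α′ : List (Change Alph k b m)) →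
    Respecting Alph k b π α α′ →
    TypeMono Alph k b π (run Alph k b Π α S) (run Alph k b Π α′ S′)
mainTheorem13 Π S S′ I π _ π-mono mono α α′ α∼α′ = run-transfer π-mono Π α∼α′ mono
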